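{- Let $m\geq 3$ and let $S(m)$ be the star with center $r$ and leaves $1,2,\dots,m$, with indeterminates $x_r,x_1,\dots,x_m$. Then $\gamma(S(m))=2$; for each $1\le k\le m-2$, \[ I_{2+k}(S(m),X)=\left\langle \prod_{s=1}^k x_{j_s}\;\middle|\; 1\le j_1<\cdots<j_k\le m\right\rangle; \] and \[ I_{m+1}(S(m),X)=\left\langle x_rx_1\cdots x_m-\sum_{i=1}^m \prod_{l\neq i} x_l\right\rangle . \]
   Context: For a graph $G$ with vertex set $V$, $L(G,X)$ is the matrix over $\mathbb{Z}[X]$, $X=\{x_v:v\in V\}$, with $L_{u,u}=x_u$, $L_{u,v}=-1$ if $uv$ is an edge and $0$ otherwise; $I_j(G,X)\subseteq\mathbb{Z}[X]$ is the ideal generated by all $j\times j$ minors of $L(G,X)$, and $\gamma(G)=\max\{j: I_j(G,X)=\mathbb{Z}[X]\}$. The star $S(m)$ has edges $r1,r2,\dots,rm$ only. -}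

module Defs where

open import Data.Nat using (ℕ; zero; suc; _≤_; _<_; _∸_; _+_)
open import Data.Integer as ℤ using (ℤ; +_; -_)
open import Data.Fin as Fin using (Fin; zero; suc; punchIn)
open import Data.Fin.Properties using (_≟_)
open import Data.Bool using (Bool; true; false; if_then_else_)
open import Data.Product using (Σ; ∃; _×_; _,_)
open import Relation.Nullary using (¬_; does)
open import Relation.Binary.PropositionalEquality using (_≡_)

-- ℤ[x_0,…,x_{n-1}] as the free commutative ring on n variables:
-- syntactic expressions modulo the congruence generated by the
-- commutative-ring axioms (plus: constants form a copy of ℤ).

infixl 6 _⊕_
infixl 7 _⊗_

data Expr (n : ℕ) : Set where
  con : ℤ → Expr n
  var : Fin n → Expr n
  _⊕_ : Expr n → Expr n → Expr n
  _⊗_ : Expr n → Expr n → Expr n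
  neg : Expr n → Expr n

𝟘 𝟙 : ∀ {n} → Expr n
𝟘 = con (+ 0)
𝟙 = con (+ 1)

infix 4 _≈_
data _≈_ {n : ℕ} : Expr n → Expr n → Set where
  ≈-refl  : ∀ {a} → a ≈ a
  ≈-sym   : ∀ {a b} → a ≈ b → b ≈ a
  ≈-trans : ∀ {a b c} → a ≈ b → b ≈ c → a ≈ c
  ⊕-cong  : ∀ {a b c d} → a ≈ b → c ≈ d → a ⊕ c ≈ b ⊕ d
  ⊗-cong  : ∀ {a b c d} → a ≈ b → c ≈ d → a ⊗ c ≈ b ⊗ d
  neg-cong : ∀ {a b} → a ≈ b → neg a ≈ neg b
  ⊕-assoc : ∀ a b c → (a ⊕ b) ⊕ c ≈ a ⊕ (b ⊕ c)
  ⊕-comm  : ∀ a b → a ⊕ b ≈ b ⊕ a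
  ⊕-idʳ   : ∀ a → a ⊕ 𝟘 ≈ a
  ⊕-invʳ  : ∀ a → a ⊕ neg a ≈ 𝟘
  ⊗-assoc : ∀ a b c → (a ⊗ b) ⊗ c ≈ a ⊗ (b ⊗ c)
  ⊗-comm  : ∀ a b → a ⊗ b ≈ b ⊗ a
  ⊗-idʳ   : ∀ a → a ⊗ 𝟙 ≈ a
  distribʳ : ∀ a b c → (a ⊕ b) ⊗ c ≈ (a ⊗ c) ⊕ (b ⊗ c)
  con-+   : ∀ i j → con i ⊕ con j ≈ con (i ℤ.+ j)
  con-*   : ∀ i j → con i ⊗ con j ≈ con (i ℤ.* j)

sumF : ∀ {n} (k : ℕ) → (Fin k → Expr n) → Expr n
sumF zero    f = 𝟘
sumF (suc k) f = f zero ⊕ sumF k (λ i → f (suc i))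

prodF : ∀ {n} (k : ℕ) → (Fin k → Expr n) → Expr n
prodF zero    f = 𝟙
prodF (suc k) f = f zero ⊗ prodF k (λ i → f (suc i))

alt : ℕ → ℤ
alt zero    = + 1
alt (suc i) = - alt i

det : ∀ {n} (k : ℕ) → (Fin k → Fin k → Expr n) → Expr n
det zero    M = 𝟙
det (suc k) M = sumF (suc k) (λ i →
  con (alt (Fin.toℕ i)) ⊗ M zero i ⊗ det k (λ a b → M (suc a) (punchIn i b)))

data InIdeal {n : ℕ} (G : Expr n → Set) : Expr n → Set where
  gen  : ∀ {p} → G p → InIdeal G p
  zro  : InIdeal G 𝟘
  add  : ∀ {p q} → InIdeal G p → InIdeal G q → InIdeal G (p ⊕ q)
  mul  : ∀ {p} (r : Expr n) → InIdeal G p → InIdeal G (r ⊗ p)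
  resp : ∀ {p q} → p ≈ q → InIdeal G p → InIdeal G q

SameIdeal : ∀ {n} → (Expr n → Set) → (Expr n → Set) → Set
SameIdeal G H = ∀ p → (InIdeal G p → InIdeal H p) × (InIdeal H p → InIdeal G p)

Whole : ∀ {n} → (Expr n → Set) → Set
Whole G = ∀ p → InIdeal G p

Graph : ℕ → Set
Graph n = Fin n → Fin n → Bool   -- adjacency (symmetric, loopless)

L : ∀ {n} → Graph n → Fin n → Fin n → Expr n
L G u v with does (u ≟ v)
... | true  = var u
... | false = if G u v then con (- (+ 1)) else 𝟘

StrictInc : ∀ {j n} → (Fin j → Fin n) → Set
StrictInc f = ∀ a b → a Fin.< b → f a Fin.< f b

Minors : ∀ {n} → (Fin n → Fin n → Expr n) → ℕ → Expr n → Set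
Minors {n} A j p = Σ (Fin j → Fin n) λ r → Σ (Fin j → Fin n) λ c →
  StrictInc r × StrictInc c × p ≡ det j (λ a b → A (r a) (c b))

IsGamma : ∀ {n} → Graph n → ℕ → Set
IsGamma G g = Whole (Minors (L G) g) × (∀ j → g < j → ¬ Whole (Minors (L G) j))

-- The star S(m): vertex zero is the center r, vertex suc (i) is leaf i+1

star : (m : ℕ) → Graph (suc m)
star m zero    zero    = false
star m zero    (suc _) = true
star m (suc _) zero    = true
star m (suc _) (suc _) = false

-- x_i for leaf i (i : Fin m, leaf number i+1)
xleaf : ∀ {m} → Fin m → Expr (suc m)
xleaf i = var (suc i)

xr : ∀ {m} → Expr (suc m)
xr = var zero

LeafProducts : (m k : ℕ) → Expr (suc m) → Set
LeafProducts m k p = Σ (Fin k → Fin m) λ js →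
  StrictInc js × p ≡ prodF k (λ s → xleaf (js s))

topPoly : (m : ℕ) → Expr (suc m)
topPoly m = (xr ⊗ prodF m xleaf) ⊕ neg (sumF m (λ i →
  prodF m (λ l → if does (l ≟ i) then 𝟙 else xleaf l)))

Single : ∀ {n} → Expr n → Expr n → Set
Single q p = p ≡ q

-- Expanding a minor of L(S(m)) along its first row, a leaf row has only two nonzero
-- entries, its diagonal entry x_l and the −1 in the centre column. As the centre row and
-- the centre column each occur at most once, every term of a j × j minor keeps at least
-- j − 2 distinct diagonal factors x_l: so I_{2+k} lies in the ideal of k-fold leaf
-- products, and every generator of I_j, j ≥ 3, vanishes at X = 0, whence γ ≤ 2.
-- Conversely, for leaves a, b outside a set J of k leaves, the minor on rows {r} ∪ J ∪ {a}
-- and columns {r} ∪ J ∪ {b} is ±∏_{j∈J} x_j, and 1 = x_r · x_1 − (x_r x_1 − 1) is a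
-- combination of 2-minors. The only (m+1)-minor is det L itself, whose expansion along
-- the centre row gives x_r x_1 ⋯ x_m − Σ_i ∏_{l≠i} x_l.

module Submission where

open import Defs
open import Level using (0ℓ)
open import Data.Nat as ℕ using (ℕ; zero; suc; _+_; _∸_; _≤_; z≤n; s≤s)
import Data.Nat.Properties as ℕP
open import Data.Integer as ℤ using (ℤ; +_; -_)
import Data.Integer.Properties as ℤP
open import Data.Fin as Fin using (Fin; zero; suc; punchIn; punchOut; toℕ)
import Data.Fin.Properties as FinP
open import Data.Fin.Properties using (_≟_)
open import Data.Bool using (if_then_else_)
open import Data.Maybe using (Maybe; just; nothing)
open import Data.Product using (Σ; ∃; _×_; _,_; proj₁; proj₂)
open import Data.Empty using (⊥-elim)
open import Function using (_∘_)
open import Function.Definitions using (Injective)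
open import Data.Vec.Functional using (_∷_; [])
open import Relation.Nullary using (¬_; yes; no; does; ¬?)
open import Relation.Binary.PropositionalEquality as ≡ using (_≡_; _≢_; refl; cong)
open import Relation.Binary.Definitions using (tri<; tri≈; tri>)
open import Algebra.Bundles using (CommutativeRing)
open import Algebra.Structures using (IsCommutativeRing)
open import Algebra.Solver.Ring.AlmostCommutativeRing
  using (_-Raw-AlmostCommutative⟶_; fromCommutativeRing)
import Algebra.Solver.Ring as RingSolver
import Relation.Binary.Reasoning.Setoid as SetoidReasoning

module _ {n : ℕ} where

  ⊕-identityˡ : (a : Expr n) → 𝟘 ⊕ a ≈ a
  ⊕-identityˡ a = ≈-trans (⊕-comm _ _) (⊕-idʳ a)

  ⊗-identityˡ : (a : Expr n) → 𝟙 ⊗ a ≈ a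
  ⊗-identityˡ a = ≈-trans (⊗-comm _ _) (⊗-idʳ a)

  ⊕-inverseˡ : (a : Expr n) → neg a ⊕ a ≈ 𝟘
  ⊕-inverseˡ a = ≈-trans (⊕-comm _ _) (⊕-invʳ a)

  distribˡ : (a b c : Expr n) → a ⊗ (b ⊕ c) ≈ (a ⊗ b) ⊕ (a ⊗ c)
  distribˡ a b c =
    ≈-trans (⊗-comm _ _) (≈-trans (distribʳ b c a) (⊕-cong (⊗-comm _ _) (⊗-comm _ _)))

  ≈-reflexive : {a b : Expr n} → a ≡ b → a ≈ b
  ≈-reflexive refl = ≈-refl

  isCommutativeRing : IsCommutativeRing (_≈_ {n}) _⊕_ _⊗_ neg 𝟘 𝟙
  isCommutativeRing = record
    { isRing = record
      { +-isAbelianGroup = record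
        { isGroup = record
          { isMonoid = record
            { isSemigroup = record
              { isMagma = record
                { isEquivalence = record { refl = ≈-refl ; sym = ≈-sym ; trans = ≈-trans }
                ; ∙-cong = ⊕-cong }
              ; assoc = ⊕-assoc }
            ; identity = ⊕-identityˡ , ⊕-idʳ }
          ; inverse = ⊕-inverseˡ , ⊕-invʳ
          ; ⁻¹-cong = neg-cong }
        ; comm = ⊕-comm }
      ; *-cong = ⊗-cong
      ; *-assoc = ⊗-assoc
      ; *-identity = ⊗-identityˡ , ⊗-idʳ
      ; distrib = distribˡ , (λ x y z → distribʳ y z x) }
    ; *-comm = ⊗-comm }

  commutativeRing : CommutativeRing 0ℓ 0ℓ
  commutativeRing = record { isCommutativeRing = isCommutativeRing }

  module ≈-Reasoning = SetoidReasoning (CommutativeRing.setoid commutativeRing)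

  con-neg : (i : ℤ) → con {n} (- i) ≈ neg (con i)
  con-neg i = begin
    con (- i)                     ≈⟨ ≈-sym (⊕-idʳ _) ⟩
    con (- i) ⊕ 𝟘                 ≈⟨ ⊕-cong ≈-refl (≈-sym (⊕-invʳ (con i))) ⟩
    con (- i) ⊕ (con i ⊕ neg (con i)) ≈⟨ ≈-sym (⊕-assoc _ _ _) ⟩
    (con (- i) ⊕ con i) ⊕ neg (con i) ≈⟨ ⊕-cong (con-+ _ _) ≈-refl ⟩
    con (- i ℤ.+ i) ⊕ neg (con i) ≈⟨ ⊕-cong (≈-reflexive (cong con (ℤP.+-inverseˡ i))) ≈-refl ⟩
    𝟘 ⊕ neg (con i)               ≈⟨ ⊕-identityˡ _ ⟩
    neg (con i)                   ∎
    where open ≈-Reasoning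

  con-homomorphism : ℤ.+-*-rawRing -Raw-AlmostCommutative⟶ fromCommutativeRing commutativeRing
  con-homomorphism = record
    { ⟦_⟧    = con
    ; +-homo = λ i j → ≈-sym (con-+ i j)
    ; *-homo = λ i j → ≈-sym (con-* i j)
    ; -‿homo = con-neg
    ; 0-homo = ≈-refl
    ; 1-homo = ≈-refl }

  con-≟ : (i j : ℤ) → Maybe (con {n} i ≈ con j)
  con-≟ i j with i ℤP.≟ j
  ... | yes refl = just ≈-refl
  ... | no _     = nothing

  module Solver = RingSolver ℤ.+-*-rawRing (fromCommutativeRing commutativeRing) con-homomorphism con-≟

alt-square : ∀ t → alt t ℤ.* alt t ≡ + 1
alt-square zero          = refl
alt-square (suc zero)    = refl
alt-square (suc (suc t)) =
  ≡.trans (cong (λ a → a ℤ.* a) (ℤP.neg-involutive (alt t))) (alt-square t)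

module _ {n : ℕ} where
  open Solver {n}

  ⊗-zeroʳ : (a : Expr n) → a ⊗ 𝟘 ≈ 𝟘
  ⊗-zeroʳ = solve 1 (λ a → a :* con (+ 0) := con (+ 0)) ≈-refl

  con-alt-move : ∀ t {x y : Expr n} → con (alt t) ⊗ x ≈ y → x ≈ con (alt t) ⊗ y
  con-alt-move t {x} {y} sx≈y = ≈-trans (≈-sym cancel) (⊗-cong ≈-refl sx≈y)
    where
    s : Expr n
    s = con (alt t)
    cancel : s ⊗ (s ⊗ x) ≈ x
    cancel = ≈-trans (solve 2 (λ s x → s :* (s :* x) := (s :* s) :* x) ≈-refl s x)
      (≈-trans (⊗-cong (≈-trans (con-* _ _) (≈-reflexive (cong con (alt-square t)))) ≈-refl)
        (⊗-identityˡ x))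

  sumF-cong : ∀ k {f g : Fin k → Expr n} → (∀ i → f i ≈ g i) → sumF k f ≈ sumF k g
  sumF-cong zero    f≈g = ≈-refl
  sumF-cong (suc k) f≈g = ⊕-cong (f≈g zero) (sumF-cong k (λ i → f≈g (suc i)))

  prodF-cong : ∀ k {f g : Fin k → Expr n} → (∀ i → f i ≈ g i) → prodF k f ≈ prodF k g
  prodF-cong zero    f≈g = ≈-refl
  prodF-cong (suc k) f≈g = ⊗-cong (f≈g zero) (prodF-cong k (λ i → f≈g (suc i)))

  sumF-zero : ∀ k {f : Fin k → Expr n} → (∀ i → f i ≈ 𝟘) → sumF k f ≈ 𝟘
  sumF-zero zero    f≈𝟘 = ≈-refl
  sumF-zero (suc k) f≈𝟘 =
    ≈-trans (⊕-cong (f≈𝟘 zero) (sumF-zero k (λ i → f≈𝟘 (suc i)))) (⊕-idʳ 𝟘)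

  sumF-single : ∀ k {f : Fin k → Expr n} (q : Fin k) → (∀ i → i ≢ q → f i ≈ 𝟘) → sumF k f ≈ f q
  sumF-single (suc k) zero    f≈𝟘 =
    ≈-trans (⊕-cong ≈-refl (sumF-zero k (λ i → f≈𝟘 (suc i) (λ ())))) (⊕-idʳ _)
  sumF-single (suc k) (suc q) f≈𝟘 =
    ≈-trans (⊕-cong (f≈𝟘 zero (λ ()))
                    (sumF-single k q (λ i i≢q → f≈𝟘 (suc i) (i≢q ∘ FinP.suc-injective))))
      (⊕-identityˡ _)

  neg-sumF : ∀ k (f : Fin k → Expr n) → sumF k (λ i → neg (f i)) ≈ neg (sumF k f)
  neg-sumF zero    f = solve 0 (con (+ 0) := :- con (+ 0)) ≈-refl
  neg-sumF (suc k) f = ≈-trans (⊕-cong ≈-refl (neg-sumF k (λ i → f (suc i))))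
    (solve 2 (λ a b → :- a :+ :- b := :- (a :+ b)) ≈-refl _ _)

  prodF-omit : ∀ k (f : Fin (suc k) → Expr n) i →
    prodF (suc k) (λ l → if does (l ≟ i) then 𝟙 else f l) ≈ prodF k (λ l → f (punchIn i l))
  prodF-omit k       f zero    = ⊗-identityˡ _
  prodF-omit (suc k) f (suc i) = ⊗-cong ≈-refl (prodF-omit k (λ l → f (suc l)) i)

minor : ∀ {k} {A : Set} → (Fin (suc k) → Fin (suc k) → A) → Fin (suc k) → Fin k → Fin k → A
minor M i a b = M (suc a) (punchIn i b)

module _ {n : ℕ} where
  open Solver {n}

  cofactorTerm : ∀ {k} → (Fin (suc k) → Fin (suc k) → Expr n) → Fin (suc k) → Expr n
  cofactorTerm {k} M i = con (alt (toℕ i)) ⊗ M zero i ⊗ det k (minor M i)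

  cofactorTerm-zeroEntry : ∀ {k} (M : Fin (suc k) → Fin (suc k) → Expr n) i →
    M zero i ≈ 𝟘 → cofactorTerm M i ≈ 𝟘
  cofactorTerm-zeroEntry M i e = ≈-trans (⊗-cong (⊗-cong ≈-refl e) ≈-refl)
    (solve 2 (λ s d → s :* con (+ 0) :* d := con (+ 0)) ≈-refl _ _)

  cofactorTerm-zeroMinor : ∀ {k} (M : Fin (suc k) → Fin (suc k) → Expr n) i →
    det k (minor M i) ≈ 𝟘 → cofactorTerm M i ≈ 𝟘
  cofactorTerm-zeroMinor M i e = ≈-trans (⊗-cong ≈-refl e) (⊗-zeroʳ _)

  det-cong : ∀ k {M N : Fin k → Fin k → Expr n} → (∀ a b → M a b ≈ N a b) → det k M ≈ det k N
  det-cong zero    M≈N = ≈-refl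
  det-cong (suc k) M≈N = sumF-cong (suc k) (λ i →
    ⊗-cong (⊗-cong (≈-refl {a = con (alt (toℕ i))}) (M≈N zero i))
           (det-cong k (λ a b → M≈N (suc a) (punchIn i b))))

  det-zeroRow : ∀ k (M : Fin k → Fin k → Expr n) a → (∀ b → M a b ≈ 𝟘) → det k M ≈ 𝟘
  det-zeroRow (suc k) M zero     row≈𝟘 =
    sumF-zero (suc k) (λ i → cofactorTerm-zeroEntry M i (row≈𝟘 i))
  det-zeroRow (suc k) M (suc a)  row≈𝟘 =
    sumF-zero (suc k) (λ i → cofactorTerm-zeroMinor M i
      (det-zeroRow k (minor M i) a (λ b → row≈𝟘 (punchIn i b))))

  det-zeroColumn : ∀ k (M : Fin k → Fin k → Expr n) b → (∀ a → M a b ≈ 𝟘) → det k M ≈ 𝟘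
  det-zeroColumn (suc k) M b column≈𝟘 = sumF-zero (suc k) term≈𝟘
    where
    term≈𝟘 : ∀ i → cofactorTerm M i ≈ 𝟘
    term≈𝟘 i with i ≟ b
    ... | yes refl = cofactorTerm-zeroEntry M i (column≈𝟘 zero)
    ... | no  i≢b  = cofactorTerm-zeroMinor M i (det-zeroColumn k (minor M i) (punchOut i≢b)
      (λ a → ≈-trans (≈-reflexive (cong (M (suc a)) (FinP.punchIn-punchOut i≢b))) (column≈𝟘 (suc a))))

  det-singleTerm : ∀ {k} (M : Fin (suc k) → Fin (suc k) → Expr n) q →
    (∀ i → i ≢ q → cofactorTerm M i ≈ 𝟘) → det (suc k) M ≈ cofactorTerm M q
  det-singleTerm {k} M = sumF-single (suc k)

  det-2×2 : (M : Fin 2 → Fin 2 → Expr n) →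
    det 2 M ≈ M zero zero ⊗ M (suc zero) (suc zero) ⊕ neg (M zero (suc zero) ⊗ M (suc zero) zero)
  -- The left-hand side is det 2 M unfolded.
  det-2×2 M = solve 4 (λ a b c d →
      con (+ 1) :* a :* (con (+ 1) :* d :* con (+ 1) :+ con (+ 0))
      :+ (con (- (+ 1)) :* b :* (con (+ 1) :* c :* con (+ 1) :+ con (+ 0)) :+ con (+ 0))
      := a :* d :- b :* c)
    ≈-refl (M zero zero) (M zero (suc zero)) (M (suc zero) zero) (M (suc zero) (suc zero))

  det-diagonal : ∀ k (M : Fin k → Fin k → Expr n) → (∀ a b → a ≢ b → M a b ≈ 𝟘) →
    det k M ≈ prodF k (λ a → M a a)
  det-diagonal zero    M off≈𝟘 = ≈-refl
  det-diagonal (suc k) M off≈𝟘 = ≈-trans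
    (det-singleTerm M zero (λ i i≢0 → cofactorTerm-zeroEntry M i (off≈𝟘 zero i (i≢0 ∘ ≡.sym))))
    (≈-trans (⊗-cong ≈-refl (det-diagonal k (minor M zero)
               (λ a b a≢b → off≈𝟘 (suc a) (suc b) (a≢b ∘ FinP.suc-injective))))
      (solve 2 (λ x p → con (+ 1) :* x :* p := x :* p) ≈-refl _ _))

module _ {n : ℕ} {G : Expr n → Set} where
  open Solver {n}

  InIdeal-sumF : ∀ k (f : Fin k → Expr n) → (∀ i → InIdeal G (f i)) → InIdeal G (sumF k f)
  InIdeal-sumF zero    f f∈ = zro
  InIdeal-sumF (suc k) f f∈ = add (f∈ zero) (InIdeal-sumF k (λ i → f (suc i)) (λ i → f∈ (suc i)))

  InIdeal-≈𝟘 : ∀ {p} → p ≈ 𝟘 → InIdeal G p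
  InIdeal-≈𝟘 p≈𝟘 = resp (≈-sym p≈𝟘) zro

  𝟙∈⇒Whole : InIdeal G 𝟙 → Whole G
  𝟙∈⇒Whole 𝟙∈ p = resp (⊗-idʳ p) (mul p 𝟙∈)

  module _ {H : Expr n → Set} where

    InIdeal-⊆ : (∀ p → G p → InIdeal H p) → ∀ {p} → InIdeal G p → InIdeal H p
    InIdeal-⊆ G⊆H (gen g)    = G⊆H _ g
    InIdeal-⊆ G⊆H zro        = zro
    InIdeal-⊆ G⊆H (add a b)  = add (InIdeal-⊆ G⊆H a) (InIdeal-⊆ G⊆H b)
    InIdeal-⊆ G⊆H (mul r a)  = mul r (InIdeal-⊆ G⊆H a)
    InIdeal-⊆ G⊆H (resp e a) = resp e (InIdeal-⊆ G⊆H a)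

    InIdeal-⊗ˡ : ∀ x → (∀ p → G p → InIdeal H (x ⊗ p)) → ∀ {p} → InIdeal G p → InIdeal H (x ⊗ p)
    InIdeal-⊗ˡ x xG⊆H (gen g)    = xG⊆H _ g
    InIdeal-⊗ˡ x xG⊆H zro        = resp (≈-sym (⊗-zeroʳ x)) zro
    InIdeal-⊗ˡ x xG⊆H (add a b)  =
      resp (≈-sym (distribˡ _ _ _)) (add (InIdeal-⊗ˡ x xG⊆H a) (InIdeal-⊗ˡ x xG⊆H b))
    InIdeal-⊗ˡ x xG⊆H (mul r a)  =
      resp (solve 3 (λ x r p → r :* (x :* p) := x :* (r :* p)) ≈-refl x r _) (mul r (InIdeal-⊗ˡ x xG⊆H a))
    InIdeal-⊗ˡ x xG⊆H (resp e a) = resp (⊗-cong ≈-refl e) (InIdeal-⊗ˡ x xG⊆H a)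

constantTerm : ∀ {n} → Expr n → ℤ
constantTerm (con i) = i
constantTerm (var _) = + 0
constantTerm (a ⊕ b) = constantTerm a ℤ.+ constantTerm b
constantTerm (a ⊗ b) = constantTerm a ℤ.* constantTerm b
constantTerm (neg a) = - constantTerm a

constantTerm-cong : ∀ {n} {a b : Expr n} → a ≈ b → constantTerm a ≡ constantTerm b
constantTerm-cong ≈-refl            = refl
constantTerm-cong (≈-sym e)         = ≡.sym (constantTerm-cong e)
constantTerm-cong (≈-trans e f)     = ≡.trans (constantTerm-cong e) (constantTerm-cong f)
constantTerm-cong (⊕-cong e f)      = ≡.cong₂ ℤ._+_ (constantTerm-cong e) (constantTerm-cong f)
constantTerm-cong (⊗-cong e f)      = ≡.cong₂ ℤ._*_ (constantTerm-cong e) (constantTerm-cong f)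
constantTerm-cong (neg-cong e)      = cong -_ (constantTerm-cong e)
constantTerm-cong (⊕-assoc a b c)   = ℤP.+-assoc (constantTerm a) (constantTerm b) (constantTerm c)
constantTerm-cong (⊕-comm a b)      = ℤP.+-comm (constantTerm a) (constantTerm b)
constantTerm-cong (⊕-idʳ a)         = ℤP.+-identityʳ (constantTerm a)
constantTerm-cong (⊕-invʳ a)        = ℤP.+-inverseʳ (constantTerm a)
constantTerm-cong (⊗-assoc a b c)   = ℤP.*-assoc (constantTerm a) (constantTerm b) (constantTerm c)
constantTerm-cong (⊗-comm a b)      = ℤP.*-comm (constantTerm a) (constantTerm b)
constantTerm-cong (⊗-idʳ a)         = ℤP.*-identityʳ (constantTerm a)
constantTerm-cong (distribʳ a b c)  = ℤP.*-distribʳ-+ (constantTerm c) (constantTerm a) (constantTerm b)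
constantTerm-cong (con-+ i j)       = refl
constantTerm-cong (con-* i j)       = refl

constantTerm-InIdeal : ∀ {n} {G : Expr n → Set} → (∀ g → G g → constantTerm g ≡ + 0) →
  ∀ {p} → InIdeal G p → constantTerm p ≡ + 0
constantTerm-InIdeal G₀ (gen g)    = G₀ _ g
constantTerm-InIdeal G₀ zro        = refl
constantTerm-InIdeal G₀ (add a b)  = ≡.cong₂ ℤ._+_ (constantTerm-InIdeal G₀ a) (constantTerm-InIdeal G₀ b)
constantTerm-InIdeal G₀ (mul r a)  =
  ≡.trans (cong (constantTerm r ℤ.*_) (constantTerm-InIdeal G₀ a)) (ℤP.*-zeroʳ (constantTerm r))
constantTerm-InIdeal G₀ (resp e a) = ≡.trans (≡.sym (constantTerm-cong e)) (constantTerm-InIdeal G₀ a)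

StrictInc-id : ∀ {n} → StrictInc {n} (λ (a : Fin n) → a)
StrictInc-id _ _ a<b = a<b

StrictInc-tail : ∀ {j n} {f : Fin (suc j) → Fin n} → StrictInc f → StrictInc (f ∘ suc)
StrictInc-tail f↑ a b a<b = f↑ (suc a) (suc b) (s≤s a<b)

StrictInc-punchIn : ∀ {j n} {f : Fin (suc j) → Fin n} → StrictInc f → ∀ i → StrictInc (f ∘ punchIn i)
StrictInc-punchIn f↑ i a b a<b = f↑ _ _ (FinP.≤∧≢⇒<
  (FinP.punchIn-mono-≤ i a b (ℕP.<⇒≤ a<b)) (FinP.<⇒≢ a<b ∘ FinP.punchIn-injective i a b))

StrictInc-cons : ∀ {j n} {x : Fin n} {f : Fin j → Fin n} →
  (∀ a → x Fin.< f a) → StrictInc f → StrictInc (x ∷ f)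
StrictInc-cons x<f f↑ zero    (suc b) _         = x<f b
StrictInc-cons x<f f↑ (suc a) (suc b) (s≤s a<b) = f↑ a b a<b

StrictInc-injective : ∀ {j n} {f : Fin j → Fin n} → StrictInc f → ∀ a b → f a ≡ f b → a ≡ b
StrictInc-injective f↑ a b e with FinP.<-cmp a b
... | tri< a<b _ _ = ⊥-elim (FinP.<⇒≢ (f↑ a b a<b) e)
... | tri≈ _ a≡b _ = a≡b
... | tri> _ _ b<a = ⊥-elim (FinP.<⇒≢ (f↑ b a b<a) (≡.sym e))

StrictInc-tail≢zero : ∀ {j n} {f : Fin (suc j) → Fin (suc n)} → StrictInc f → ∀ a → f (suc a) ≢ zero
StrictInc-tail≢zero f↑ a e with f↑ zero (suc a) (s≤s z≤n)
... | f0<fa rewrite e = ℕP.n≮0 f0<fa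

StrictInc-lowerBound : ∀ {j n} {f : Fin (suc j) → Fin n} → StrictInc f →
  ∀ a → toℕ (f zero) + toℕ a ≤ toℕ (f a)
StrictInc-lowerBound f↑ zero = ℕP.≤-reflexive (ℕP.+-identityʳ _)
StrictInc-lowerBound {suc j} {f = f} f↑ (suc a) = begin
  toℕ (f zero) + suc (toℕ a)      ≡⟨ ℕP.+-suc _ _ ⟩
  suc (toℕ (f zero)) + toℕ a      ≤⟨ ℕP.+-monoˡ-≤ (toℕ a) (f↑ zero (suc zero) (s≤s z≤n)) ⟩
  toℕ (f (suc zero)) + toℕ a      ≤⟨ StrictInc-lowerBound (StrictInc-tail f↑) a ⟩
  toℕ (f (suc a))                 ∎
  where open ℕP.≤-Reasoning

StrictInc-upperBound : ∀ {j n} {f : Fin j → Fin n} → StrictInc f →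
  ∀ a → toℕ (f a) + j ≤ n + toℕ a
StrictInc-upperBound {suc zero} {n} {f} f↑ zero = begin
  toℕ (f zero) + 1   ≡⟨ ℕP.+-comm _ 1 ⟩
  suc (toℕ (f zero)) ≤⟨ FinP.toℕ<n (f zero) ⟩
  n                  ≡⟨ ℕP.+-identityʳ n ⟨
  n + 0              ∎
  where open ℕP.≤-Reasoning
StrictInc-upperBound {suc (suc j)} {n} {f} f↑ zero = begin
  toℕ (f zero) + suc (suc j)     ≡⟨ ℕP.+-suc _ _ ⟩
  suc (toℕ (f zero)) + suc j     ≤⟨ ℕP.+-monoˡ-≤ (suc j) (f↑ zero (suc zero) (s≤s z≤n)) ⟩
  toℕ (f (suc zero)) + suc j     ≤⟨ StrictInc-upperBound (StrictInc-tail f↑) zero ⟩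
  n + 0                          ∎
  where open ℕP.≤-Reasoning
StrictInc-upperBound {suc j} {n} {f} f↑ (suc a) = begin
  toℕ (f (suc a)) + suc j      ≡⟨ ℕP.+-suc _ _ ⟩
  suc (toℕ (f (suc a)) + j)    ≤⟨ s≤s (StrictInc-upperBound (StrictInc-tail f↑) a) ⟩
  suc (n + toℕ a)              ≡⟨ ℕP.+-suc n (toℕ a) ⟨
  n + suc (toℕ a)              ∎
  where open ℕP.≤-Reasoning

StrictInc-endo⇒id : ∀ {n} {f : Fin n → Fin n} → StrictInc f → ∀ a → f a ≡ a
StrictInc-endo⇒id {suc n} {f} f↑ a = FinP.toℕ-injective (ℕP.≤-antisym fa≤a a≤fa)
  where
  fa≤a : toℕ (f a) ≤ toℕ a
  fa≤a = ℕP.+-cancelʳ-≤ (suc n) _ _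
    (ℕP.≤-trans (StrictInc-upperBound f↑ a) (ℕP.≤-reflexive (ℕP.+-comm (suc n) (toℕ a))))
  a≤fa : toℕ a ≤ toℕ (f a)
  a≤fa = ℕP.≤-trans (ℕP.m≤n+m (toℕ a) (toℕ (f zero))) (StrictInc-lowerBound f↑ a)

∃-notInImage : ∀ {k m} (J : Fin k → Fin m) → k ℕ.< m → ∃ λ a → ∀ i → J i ≢ a
∃-notInImage J k<m with FinP.any? (λ a → ¬? (FinP.any? (λ i → J i ≟ a)))
... | yes (a , a∉J) = a , λ i e → a∉J (i , e)
... | no  J-onto    = ⊥-elim (ℕP.<⇒≱ k<m (FinP.injective⇒≤ preimage-injective))
  where
  hit : ∀ a → ∃ λ i → J i ≡ a
  hit a with FinP.any? (λ i → J i ≟ a)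
  ... | yes i,e = i,e
  ... | no  a∉J = ⊥-elim (J-onto (a , a∉J))
  preimage-injective : Injective _≡_ _≡_ (proj₁ ∘ hit)
  preimage-injective {a} {b} e =
    ≡.trans (≡.sym (proj₂ (hit a))) (≡.trans (cong J e) (proj₂ (hit b)))

record Insertion {k m : ℕ} (J : Fin k → Fin m) (a : Fin m) : Set where
  field
    seq    : Fin (suc k) → Fin m
    pos    : Fin (suc k)
    strict : StrictInc seq
    at-pos : seq pos ≡ a
    others : ∀ i → seq (punchIn pos i) ≡ J i

insertion : ∀ {k m} (J : Fin k → Fin m) → StrictInc J → (a : Fin m) → (∀ i → J i ≢ a) → Insertion J a
insertion {zero} J J↑ a a∉J = record
  { seq = λ _ → a ; pos = zero ; strict = λ { zero zero () } ; at-pos = refl ; others = λ () }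
insertion {suc k} J J↑ a a∉J with FinP.<-cmp a (J zero)
... | tri< a<J0 _ _ = record
  { seq = a ∷ J ; pos = zero ; strict = StrictInc-cons a<J J↑ ; at-pos = refl ; others = λ _ → refl }
  where
  a<J : ∀ b → a Fin.< J b
  a<J zero    = a<J0
  a<J (suc b) = ℕP.<-trans a<J0 (J↑ zero (suc b) (s≤s z≤n))
... | tri≈ _ a≡J0 _ = ⊥-elim (a∉J zero (≡.sym a≡J0))
... | tri> _ _ J0<a = record
  { seq = J zero ∷ seq ; pos = suc pos ; strict = StrictInc-cons J0<seq strict
  ; at-pos = at-pos ; others = λ { zero → refl ; (suc i) → others i } }
  where
  open Insertion (insertion (J ∘ suc) (StrictInc-tail J↑) a (a∉J ∘ suc))
  J0<seq : ∀ s → J zero Fin.< seq s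
  J0<seq s with pos ≟ s
  ... | yes refl = ≡.subst (J zero Fin.<_) (≡.sym at-pos) J0<a
  ... | no  pos≢s = ≡.subst (J zero Fin.<_)
          (≡.trans (≡.sym (others (punchOut pos≢s))) (cong seq (FinP.punchIn-punchOut pos≢s)))
          (J↑ zero (suc (punchOut pos≢s)) (s≤s z≤n))

Insertion-∉ : ∀ {k m} {J : Fin k → Fin m} {a b : Fin m} (A : Insertion J a) →
  a ≢ b → (∀ i → J i ≢ b) → ∀ y → Insertion.seq A y ≢ b
Insertion-∉ A a≢b J∌b y with Insertion.pos A ≟ y
... | yes refl = λ e → a≢b (≡.trans (≡.sym (Insertion.at-pos A)) e)
... | no  pos≢y = λ e → J∌b (punchOut pos≢y)
        (≡.trans (≡.sym (others (punchOut pos≢y))) (≡.trans (cong seq (FinP.punchIn-punchOut pos≢y)) e))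
  where open Insertion A

-- Minors of L(S(m)) lie in ideals of leaf products

module _ {m : ℕ} where

  L-leaf-diagonal : ∀ l → L (star m) (suc l) (suc l) ≡ xleaf l
  L-leaf-diagonal l with l ≟ l
  ... | yes _  = refl
  ... | no l≢l = ⊥-elim (l≢l refl)

  L-leaf-offDiagonal : ∀ {l l'} → l ≢ l' → L (star m) (suc l) (suc l') ≡ 𝟘
  L-leaf-offDiagonal {l} {l'} l≢l' with l ≟ l'
  ... | yes l≡l' = ⊥-elim (l≢l' l≡l')
  ... | no  _    = refl

isCentre : ∀ {m} → Fin (suc m) → ℕ
isCentre zero    = 1
isCentre (suc _) = 0

-- For a strictly increasing index sequence the centre can only occur first, so this
-- counts the occurrences of the centre.
centreCount : ∀ {j m} → (Fin j → Fin (suc m)) → ℕ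
centreCount {zero}  f = 0
centreCount {suc j} f = isCentre (f zero)

centreCount≤1 : ∀ {j m} (f : Fin j → Fin (suc m)) → centreCount f ≤ 1
centreCount≤1 {zero}  f = z≤n
centreCount≤1 {suc j} f with f zero
... | zero  = s≤s z≤n
... | suc _ = z≤n

centreCount-tail : ∀ {j m} {f : Fin (suc j) → Fin (suc m)} → StrictInc f → centreCount (f ∘ suc) ≡ 0
centreCount-tail {zero}  f↑ = refl
centreCount-tail {suc j} {f = f} f↑ with f (suc zero) | StrictInc-tail≢zero f↑ zero
... | zero  | f1≢0 = ⊥-elim (f1≢0 refl)
... | suc _ | _    = refl

centreCount-punchIn : ∀ {j m} {c : Fin (suc j) → Fin (suc m)} → StrictInc c →
  ∀ i → centreCount (c ∘ punchIn i) ≤ centreCount c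
centreCount-punchIn {zero}  c↑ i       = z≤n
centreCount-punchIn {suc j} c↑ zero    = ℕP.≤-trans (ℕP.≤-reflexive (centreCount-tail c↑)) z≤n
centreCount-punchIn {suc j} c↑ (suc i) = ℕP.≤-refl

centreCount-punchIn-centre : ∀ {j m} {c : Fin (suc j) → Fin (suc m)} → StrictInc c →
  ∀ i → c i ≡ zero → suc (centreCount (c ∘ punchIn i)) ≤ centreCount c
centreCount-punchIn-centre {c = c} c↑ zero c0≡0 rewrite c0≡0 | centreCount-tail c↑ = ℕP.≤-refl
centreCount-punchIn-centre c↑ (suc i) ci≡0 = ⊥-elim (StrictInc-tail≢zero c↑ i ci≡0)

centreCount-budget : ∀ {j m} (r c : Fin j → Fin (suc m)) e → centreCount r + centreCount c + e ≤ 2 + e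
centreCount-budget r c e = ℕP.+-monoˡ-≤ e (ℕP.+-mono-≤ (centreCount≤1 r) (centreCount≤1 c))

-- Remembering that the leaves index rows keeps the leaf sequence increasing when the
-- first row's leaf is prepended.
RowLeafProducts : ∀ {j m} (e : ℕ) (r : Fin j → Fin (suc m)) → Expr (suc m) → Set
RowLeafProducts {m = m} e r p = Σ (Fin e → Fin m) λ js →
  StrictInc js × (∀ s → ∃ λ a → r a ≡ suc (js s)) × p ≡ prodF e (λ s → xleaf (js s))

module _ {j m : ℕ} {r : Fin (suc j) → Fin (suc m)} where

  RowLeafProducts-tail : ∀ {e p} → RowLeafProducts e (r ∘ suc) p → RowLeafProducts e r p
  RowLeafProducts-tail (js , js↑ , js∈r , refl) =
    js , js↑ , (λ s → suc (proj₁ (js∈r s)) , proj₂ (js∈r s)) , refl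

  RowLeafProducts-cons : ∀ {e p} l → r zero ≡ suc l → StrictInc r →
    RowLeafProducts e (r ∘ suc) p → RowLeafProducts (suc e) r (xleaf l ⊗ p)
  RowLeafProducts-cons l r0≡l r↑ (js , js↑ , js∈r , refl) =
    l ∷ js , StrictInc-cons l<js js↑ , l∷js∈r , refl
    where
    l<js : ∀ s → l Fin.< js s
    l<js s with r↑ zero (suc (proj₁ (js∈r s))) (s≤s z≤n)
    ... | r0<r rewrite r0≡l | proj₂ (js∈r s) = ℕP.≤-pred r0<r
    l∷js∈r : ∀ s → ∃ λ a → r a ≡ suc ((l ∷ js) s)
    l∷js∈r zero    = zero , r0≡l
    l∷js∈r (suc s) = suc (proj₁ (js∈r s)) , proj₂ (js∈r s)

minor∈RowLeafProducts : ∀ {m} j (r c : Fin j → Fin (suc m)) → StrictInc r → StrictInc c →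
  ∀ e → centreCount r + centreCount c + e ≤ j →
  InIdeal (RowLeafProducts e r) (det j (λ a b → L (star m) (r a) (c b)))
minor∈RowLeafProducts j r c r↑ c↑ zero _ = 𝟙∈⇒Whole (gen ((λ ()) , (λ ()) , (λ ()) , refl)) _
minor∈RowLeafProducts {m} (suc j) r c r↑ c↑ (suc e) budget = InIdeal-sumF (suc j) _ term∈
  where
  M : Fin (suc j) → Fin (suc j) → Expr (suc m)
  M a b = L (star m) (r a) (c b)

  minor∈ : ∀ i e' → centreCount (c ∘ punchIn i) + e' ≤ j →
    InIdeal (RowLeafProducts e' (r ∘ suc)) (det j (minor M i))
  minor∈ i e' bd = minor∈RowLeafProducts j (r ∘ suc) (c ∘ punchIn i) (StrictInc-tail r↑)
    (StrictInc-punchIn c↑ i) e' (≡.subst (λ z → z + _ + e' ≤ j) (≡.sym (centreCount-tail r↑)) bd)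

  budget' : ∀ {x} → r zero ≡ x → isCentre x + centreCount c + suc e ≤ suc j
  budget' r0≡x = ≡.subst (λ z → isCentre z + centreCount c + suc e ≤ suc j) r0≡x budget

  lift : ∀ {e' p} → InIdeal (RowLeafProducts e' (r ∘ suc)) p → InIdeal (RowLeafProducts e' r) p
  lift = InIdeal-⊆ (λ _ → gen ∘ RowLeafProducts-tail)

  term∈ : ∀ i → InIdeal (RowLeafProducts (suc e) r) (cofactorTerm M i)
  term∈ i = byEntry (r zero) (c i) refl refl
    where
    byEntry : ∀ x y → r zero ≡ x → c i ≡ y → InIdeal (RowLeafProducts (suc e) r) (cofactorTerm M i)
    byEntry zero    _        r0≡ _   = mul _ (lift (minor∈ i (suc e)
      (ℕP.≤-pred (ℕP.≤-trans (ℕP.+-monoˡ-≤ (suc e) (s≤s (centreCount-punchIn c↑ i))) (budget' r0≡)))))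
    byEntry (suc l) zero     r0≡ ci≡ = mul _ (lift (minor∈ i (suc e)
      (ℕP.≤-pred (ℕP.≤-trans (ℕP.+-monoˡ-≤ (suc e) (centreCount-punchIn-centre c↑ i ci≡)) (budget' r0≡)))))
    byEntry (suc l) (suc l') r0≡ ci≡ with l ≟ l'
    ... | no l≢l'  = InIdeal-≈𝟘 (cofactorTerm-zeroEntry M i
      (≈-reflexive (≡.trans (≡.cong₂ (L (star m)) r0≡ ci≡) (L-leaf-offDiagonal l≢l'))))
    ... | yes refl = resp (≈-trans (≈-sym (⊗-assoc _ _ _)) (⊗-cong (⊗-cong ≈-refl entry) ≈-refl))
      (mul _ (InIdeal-⊗ˡ (xleaf l) (λ _ q → gen (RowLeafProducts-cons l r0≡ r↑ q)) (minor∈ i e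
        (ℕP.≤-pred (≡.subst (_≤ suc j) (ℕP.+-suc _ e)
          (ℕP.≤-trans (ℕP.+-monoˡ-≤ (suc e) (centreCount-punchIn c↑ i)) (budget' r0≡)))))))
      where
      entry : xleaf l ≈ M zero i
      entry = ≈-reflexive (≡.sym (≡.trans (≡.cong₂ (L (star m)) r0≡ ci≡) (L-leaf-diagonal l)))

-- Minors of L(S(m)) computed exactly

withCentre : ∀ {k m} → (Fin k → Fin m) → Fin (suc k) → Fin (suc m)
withCentre J = zero ∷ suc ∘ J

withCentre-punchIn : ∀ {k m} (J : Fin (suc k) → Fin m) i b →
  withCentre J (punchIn (suc i) b) ≡ withCentre (J ∘ punchIn i) b
withCentre-punchIn J i zero    = refl
withCentre-punchIn J i (suc b) = refl

withCentre-cong : ∀ {k m} {J J' : Fin k → Fin m} → (∀ i → J i ≡ J' i) →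
  ∀ b → withCentre J b ≡ withCentre J' b
withCentre-cong J≡J' zero    = refl
withCentre-cong J≡J' (suc b) = cong suc (J≡J' b)

StrictInc-withCentre : ∀ {k m} {J : Fin k → Fin m} → StrictInc J → StrictInc (withCentre J)
StrictInc-withCentre J↑ = StrictInc-cons (λ _ → s≤s z≤n) (λ a b a<b → s≤s (J↑ a b a<b))

module _ {m : ℕ} where
  open Solver {suc m}

  det-leafDiagonal : ∀ k (R : Fin k → Fin m) → StrictInc R →
    det k (λ a b → L (star m) (suc (R a)) (suc (R b))) ≈ prodF k (xleaf ∘ R)
  det-leafDiagonal k R R↑ = ≈-trans
    (det-diagonal k _ (λ a b a≢b → ≈-reflexive
      (L-leaf-offDiagonal (a≢b ∘ StrictInc-injective R↑ a b))))
    (prodF-cong k (λ a → ≈-reflexive (L-leaf-diagonal (R a))))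

  det-leafRows-withCentre : ∀ k (A : Fin (suc k) → Fin m) (J : Fin k → Fin m) p →
    StrictInc A → StrictInc J → (∀ i → A (punchIn p i) ≡ J i) →
    det (suc k) (λ a b → L (star m) (suc (A a)) (withCentre J b))
      ≈ con (alt (suc (toℕ p))) ⊗ prodF k (xleaf ∘ J)
  det-leafRows-withCentre k A J zero A↑ J↑ A∖p≡J = ≈-trans
    (det-singleTerm M zero (λ
      { zero    0≢0 → ⊥-elim (0≢0 refl)
      ; (suc i) _   → cofactorTerm-zeroEntry M (suc i) (≈-reflexive (L-leaf-offDiagonal
          (λ e → 0≢suc (StrictInc-injective A↑ _ _ (≡.trans e (≡.sym (A∖p≡J i))))))) }))
    (≈-trans (⊗-cong ≈-refl (≈-trans
        (det-cong k (λ a b → ≈-reflexive (cong (λ x → L (star m) (suc x) (suc (J b))) (A∖p≡J a))))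
        (det-leafDiagonal k J J↑)))
      (solve 1 (λ p → con (+ 1) :* con (- (+ 1)) :* p := con (- (+ 1)) :* p) ≈-refl _))
    where
    M : Fin (suc k) → Fin (suc k) → Expr (suc m)
    M a b = L (star m) (suc (A a)) (withCentre J b)
    0≢suc : ∀ {i : Fin k} → zero ≢ suc i
    0≢suc ()
  det-leafRows-withCentre (suc k) A J (suc p) A↑ J↑ A∖p≡J = ≈-trans
    (det-singleTerm M (suc zero) (λ
      { zero _ → cofactorTerm-zeroMinor M zero (det-zeroColumn (suc k) (minor M zero) zero (λ a → ≈-reflexive
          (L-leaf-offDiagonal (λ e → suc≢0 (StrictInc-injective A↑ _ _ (≡.trans e (≡.sym A0≡J0)))))))
      ; (suc zero)    1≢1 → ⊥-elim (1≢1 refl)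
      ; (suc (suc i)) _   → cofactorTerm-zeroEntry M (suc (suc i)) (≈-reflexive (L-leaf-offDiagonal
          (λ e → 0≢suc (StrictInc-injective J↑ _ _ (≡.trans (≡.sym A0≡J0) e))))) }))
    (≈-trans (⊗-cong (⊗-cong ≈-refl entry) (≈-trans
        (det-cong (suc k) (λ a b → ≈-reflexive
          (cong (L (star m) (suc (A (suc a)))) (withCentre-punchIn J zero b))))
        (det-leafRows-withCentre k (A ∘ suc) (J ∘ suc) p
          (StrictInc-tail A↑) (StrictInc-tail J↑) (A∖p≡J ∘ suc))))
      (≈-trans (solve 4 (λ a x b q → a :* x :* (b :* q) := (a :* b) :* (x :* q)) ≈-refl _ _ _ _)
        (⊗-cong (≈-trans (con-* _ _) (≈-reflexive (cong con (ℤP.-1*i≡-i _)))) ≈-refl)))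
    where
    M : Fin (suc (suc k)) → Fin (suc (suc k)) → Expr (suc m)
    M a b = L (star m) (suc (A a)) (withCentre J b)
    A0≡J0 : A zero ≡ J zero
    A0≡J0 = A∖p≡J zero
    entry : M zero (suc zero) ≈ xleaf (J zero)
    entry = ≈-reflexive (≡.trans (cong (λ x → L (star m) (suc x) (suc (J zero))) A0≡J0)
                                 (L-leaf-diagonal (J zero)))
    0≢suc : ∀ {i : Fin k} → zero ≢ suc i
    0≢suc ()
    suc≢0 : ∀ {i : Fin (suc k)} → suc i ≢ zero
    suc≢0 ()

  det-withCentre-insertions : ∀ k {J : Fin k → Fin m} {a b} → StrictInc J →
    (A : Insertion J a) (B : Insertion J b) → a ≢ b → (∀ i → J i ≢ a) → (∀ i → J i ≢ b) →
    det (suc (suc k)) (λ x y → L (star m) (withCentre (Insertion.seq A) x) (withCentre (Insertion.seq B) y))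
      ≈ con (alt (suc (toℕ (Insertion.pos B))))
          ⊗ (con (alt 1) ⊗ (con (alt (suc (toℕ (Insertion.pos A)))) ⊗ prodF k (xleaf ∘ J)))
  det-withCentre-insertions k {J} {a} {b} J↑ A B a≢b J∌a J∌b = ≈-trans
    (det-singleTerm M (suc (pos B)) vanish)
    (≈-trans (⊗-cong ≈-refl (≈-trans
        (det-cong (suc k) (λ x y → ≈-reflexive (cong (L (star m) (suc (seq A x)))
          (≡.trans (withCentre-punchIn (seq B) (pos B) y) (withCentre-cong (others B) y)))))
        (det-leafRows-withCentre k (seq A) J (pos A) (strict A) J↑ (others A))))
      (⊗-assoc _ _ _))
    where
    open Insertion
    M : Fin (suc (suc k)) → Fin (suc (suc k)) → Expr (suc m)
    M x y = L (star m) (withCentre (seq A) x) (withCentre (seq B) y)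
    A∌b : ∀ x → seq A x ≢ b
    A∌b = Insertion-∉ A a≢b J∌b
    B∌a : ∀ y → seq B y ≢ a
    B∌a = Insertion-∉ B (a≢b ∘ ≡.sym) J∌a
    vanish : ∀ i → i ≢ suc (pos B) → cofactorTerm M i ≈ 𝟘
    vanish zero    _ = cofactorTerm-zeroMinor M zero (det-zeroRow (suc k) (minor M zero) (pos A)
      (λ y → ≈-reflexive (L-leaf-offDiagonal (λ e → B∌a y (≡.trans (≡.sym e) (at-pos A))))))
    vanish (suc i) i≢q with i ≟ pos B
    ... | yes refl = ⊥-elim (i≢q refl)
    ... | no  i≢q' = cofactorTerm-zeroMinor M (suc i)
      (det-zeroColumn (suc k) (minor M (suc i)) (suc (punchOut i≢q')) (λ x → ≈-reflexive
        (L-leaf-offDiagonal (λ e → A∌b x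
          (≡.trans e (≡.trans (cong (seq B) (FinP.punchIn-punchOut i≢q')) (at-pos B)))))))

det-L-star : ∀ m → det (suc (suc m)) (L (star (suc m))) ≈ topPoly (suc m)
det-L-star m = ⊕-cong centreTerm
  (≈-trans (sumF-cong (suc m) leafTerm) (neg-sumF (suc m) (λ i → prodF (suc m) (omit i))))
  where
  open Solver {suc (suc m)}
  M : Fin (suc (suc m)) → Fin (suc (suc m)) → Expr (suc (suc m))
  M = L (star (suc m))
  omit : Fin (suc m) → Fin (suc m) → Expr (suc (suc m))
  omit i l = if does (l ≟ i) then 𝟙 else xleaf l
  centreTerm : cofactorTerm M zero ≈ xr ⊗ prodF (suc m) xleaf
  centreTerm = ≈-trans (⊗-cong ≈-refl (det-leafDiagonal (suc m) (λ l → l) StrictInc-id))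
    (solve 2 (λ x p → con (+ 1) :* x :* p := x :* p) ≈-refl _ _)
  punchIn-suc : ∀ i b → punchIn (suc i) b ≡ withCentre (punchIn i) b
  punchIn-suc i zero    = refl
  punchIn-suc i (suc b) = refl
  leafTerm : ∀ i → cofactorTerm M (suc i) ≈ neg (prodF (suc m) (omit i))
  leafTerm i = begin
    s ⊗ con (alt 1) ⊗ det (suc m) (minor M (suc i))
      ≈⟨ ⊗-cong ≈-refl (≈-trans
           (det-cong (suc m) (λ a b → ≈-reflexive (cong (M (suc a)) (punchIn-suc i b))))
           (det-leafRows-withCentre m (λ l → l) (punchIn i) i StrictInc-id
             (StrictInc-punchIn StrictInc-id i) (λ _ → refl))) ⟩
    s ⊗ con (alt 1) ⊗ (s ⊗ P)
      ≈⟨ solve 3 (λ s u p → s :* u :* (s :* p) := u :* (s :* (s :* p))) ≈-refl s _ P ⟩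
    con (alt 1) ⊗ (s ⊗ (s ⊗ P))
      ≈⟨ ⊗-cong ≈-refl (≈-sym (con-alt-move (suc (toℕ i)) ≈-refl)) ⟩
    con (alt 1) ⊗ P
      ≈⟨ solve 1 (λ p → con (- (+ 1)) :* p := :- p) ≈-refl P ⟩
    neg P
      ≈⟨ neg-cong (≈-sym (prodF-omit m xleaf i)) ⟩
    neg (prodF (suc m) (omit i)) ∎
    where
    open ≈-Reasoning
    s P : Expr (suc (suc m))
    s = con (alt (suc (toℕ i)))
    P = prodF m (xleaf ∘ punchIn i)

module _ (m : ℕ) where

  Minors⊆LeafProducts : ∀ k p → Minors (L (star m)) (2 + k) p → InIdeal (LeafProducts m k) p
  Minors⊆LeafProducts k p (r , c , r↑ , c↑ , refl) =
    InIdeal-⊆ (λ { _ (js , js↑ , _ , p≡) → gen (js , js↑ , p≡) })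
      (minor∈RowLeafProducts (2 + k) r c r↑ c↑ k (centreCount-budget r c k))

  Minors-notWhole : ∀ j → 2 ℕ.< j → ¬ Whole (Minors (L (star m)) j)
  Minors-notWhole (suc zero)       (s≤s ())
  Minors-notWhole (suc (suc zero)) (s≤s (s≤s ()))
  Minors-notWhole (suc (suc (suc j))) _ whole = +1≢+0 (constantTerm-InIdeal minor₀ (whole 𝟙))
    where
    +1≢+0 : + 1 ≢ + 0
    +1≢+0 ()
    minor₀ : ∀ g → Minors (L (star m)) (3 + j) g → constantTerm g ≡ + 0
    minor₀ g (r , c , r↑ , c↑ , refl) = constantTerm-InIdeal (λ { _ (_ , _ , _ , refl) → refl })
      (minor∈RowLeafProducts (3 + j) r c r↑ c↑ (suc j) (centreCount-budget r c (suc j)))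

  LeafProducts⊆Minors : ∀ k → 2 + k ≤ m →
    ∀ p → LeafProducts m k p → InIdeal (Minors (L (star m)) (2 + k)) p
  LeafProducts⊆Minors k 2+k≤m p (J , J↑ , refl) =
    resp (≈-sym (con-alt-move (suc (toℕ (pos A))) (con-alt-move 1 (con-alt-move (suc (toℕ (pos B)))
          (≈-sym (det-withCentre-insertions k J↑ A B a≢b J∌a J∌b))))))
      (mul _ (mul _ (mul _ (gen (withCentre (seq A) , withCentre (seq B) ,
        StrictInc-withCentre (strict A) , StrictInc-withCentre (strict B) , refl)))))
    where
    open Insertion
    freshA : ∃ λ a → ∀ i → J i ≢ a
    freshA = ∃-notInImage J (ℕP.≤-trans (ℕP.n≤1+n _) 2+k≤m)
    a : Fin m
    a = proj₁ freshA
    J∌a : ∀ i → J i ≢ a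
    J∌a = proj₂ freshA
    A : Insertion J a
    A = insertion J J↑ a J∌a
    freshB : ∃ λ b → ∀ x → seq A x ≢ b
    freshB = ∃-notInImage (seq A) 2+k≤m
    b : Fin m
    b = proj₁ freshB
    A∌b : ∀ x → seq A x ≢ b
    A∌b = proj₂ freshB
    J∌b : ∀ i → J i ≢ b
    J∌b i e = A∌b (punchIn (pos A) i) (≡.trans (others A i) e)
    B : Insertion J b
    B = insertion J J↑ b J∌b
    a≢b : a ≢ b
    a≢b e = A∌b (pos A) (≡.trans (at-pos A) e)

module _ (m : ℕ) where

  Minors⊆topPoly : ∀ p → Minors (L (star (suc m))) (suc (suc m)) p → InIdeal (Single (topPoly (suc m))) p
  Minors⊆topPoly p (r , c , r↑ , c↑ , refl) = resp (≈-sym (≈-trans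
    (det-cong (suc (suc m)) (λ a b → ≈-reflexive
      (≡.cong₂ (L (star (suc m))) (StrictInc-endo⇒id r↑ a) (StrictInc-endo⇒id c↑ b))))
    (det-L-star m))) (gen refl)

  topPoly⊆Minors : ∀ p → Single (topPoly (suc m)) p → InIdeal (Minors (L (star (suc m))) (suc (suc m))) p
  topPoly⊆Minors p refl =
    resp (det-L-star m) (gen ((λ a → a) , (λ b → b) , StrictInc-id , StrictInc-id , refl))

  -- x_r · x_1 − (x_r x_1 − 1) = 1, where x_1 and x_r x_1 − 1 are the minors on rows {r, 1}
  -- and columns {1, 2}, resp. {r, 1}.
  Minors₂-whole : Whole (Minors (L (star (suc (suc m)))) 2)
  Minors₂-whole = 𝟙∈⇒Whole (resp combination
    (add (mul xr (gen (r1 , l12 , pair↑ (s≤s z≤n) , pair↑ (s≤s (s≤s z≤n)) , refl)))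
         (mul (con (- (+ 1))) (gen (r1 , r1 , pair↑ (s≤s z≤n) , pair↑ (s≤s z≤n) , refl)))))
    where
    open Solver {suc (suc (suc m))}
    pair : Fin (suc (suc (suc m))) → Fin (suc (suc (suc m))) → Fin 2 → Fin (suc (suc (suc m)))
    pair x y = x ∷ y ∷ []
    pair↑ : ∀ {x y} → x Fin.< y → StrictInc (pair x y)
    pair↑ x<y = StrictInc-cons (λ { zero → x<y }) (λ { zero zero () })
    r1 l12 : Fin 2 → Fin (suc (suc (suc m)))
    r1 = pair zero (suc zero)
    l12 = pair (suc zero) (suc (suc zero))
    minorOn : (Fin 2 → Fin (suc (suc (suc m)))) → Fin 2 → Fin 2 → Expr (suc (suc (suc m)))
    minorOn cols a b = L (star (suc (suc m))) (r1 a) (cols b)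
    combination : xr ⊗ det 2 (minorOn l12) ⊕ con (- (+ 1)) ⊗ det 2 (minorOn r1) ≈ 𝟙
    combination = ≈-trans
      (⊕-cong (⊗-cong ≈-refl (det-2×2 (minorOn l12))) (⊗-cong ≈-refl (det-2×2 (minorOn r1))))
      (solve 2 (λ r x → r :* (con (- (+ 1)) :* con (+ 0) :- con (- (+ 1)) :* x)
                       :+ con (- (+ 1)) :* (r :* x :- con (- (+ 1)) :* con (- (+ 1))) := con (+ 1))
        ≈-refl xr (xleaf zero))

theorem5p1 : (m : ℕ) → 3 ≤ m →
    IsGamma (star m) 2
    × (∀ k → 1 ≤ k → k ≤ m ∸ 2 →
         SameIdeal (Minors (L (star m)) (2 + k)) (LeafProducts m k))
    × SameIdeal (Minors (L (star m)) (suc m)) (Single (topPoly m))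
theorem5p1 (suc (suc (suc m))) (s≤s (s≤s (s≤s z≤n))) =
    (Minors₂-whole (suc m) , Minors-notWhole (3 + m))
  , (λ k _ k≤m∸2 p → InIdeal-⊆ (Minors⊆LeafProducts (3 + m) k)
                   , InIdeal-⊆ (LeafProducts⊆Minors (3 + m) k (s≤s (s≤s k≤m∸2))))
  , (λ p → InIdeal-⊆ (Minors⊆topPoly (2 + m)) , InIdeal-⊆ (topPoly⊆Minors (2 + m)))
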